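{- Let $R$ be a subset of a commutative ring $A$ (with identity), let $\lambda,\lambda',\lambda''\in\{\pm1\}$ and $k,l,m>2$. Let $a=(a_1,\dots,a_k)\in R^k$ be a $\lambda$-quiddity cycle, $b=(b_1,\dots,b_l)\in R^l$ a $\lambda'$-quiddity cycle and $c=(c_1,\dots,c_m)\in R^m$ a $\lambda''$-quiddity cycle. Then: (1) $a\oplus b\sim b\oplus a$. (2) There exist $\tau\in D_l$ and $\sigma\in D_{l+m-2}$ such that $(a\oplus b)\oplus c=a\oplus(b^\tau\oplus c)^\sigma$. (3) Let $\sigma\in D_{l+m-2}$. Then either $a\oplus(b\oplus c)^\sigma\sim(a\oplus c^{\tau_1})^{\tau_2}\oplus b$ for some $\tau_1\in D_m$, $\tau_2\in D_{k+m-2}$, or $a\oplus(b\oplus c)^\sigma\sim(a\oplus b^{\tau_1})^{\tau_2}\oplus c$ for some $\tau_1\in D_l$, $\tau_2\in D_{k+l-2}$. (4) If $k=l$, $\lambda=\lambda'$ and $a\oplus b=b\oplus a$, then $a=b$.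
   Context: For $\mu\in\{\pm1\}$, a $\mu$-quiddity cycle is a finite sequence $c=(c_1,\dots,c_n)$ of ring elements such that $\prod_{t=1}^{n}\begin{pmatrix} c_t & -1\\ 1 & 0\end{pmatrix}=\mu\,\mathrm{id}$ (product in the order $t=1,\dots,n$). For sequences $a=(a_1,\dots,a_k)$, $b=(b_1,\dots,b_l)$ one defines $a\oplus b=(a_1+b_l,a_2,\dots,a_{k-1},a_k+b_1,b_2,\dots,b_{l-1})$ (sums in $A$), a sequence of length $k+l-2$. Let $D_n$ be the dihedral group acting on the positions $\{1,\dots,n\}$ (generated by the rotation $i\mapsto i+1 \bmod n$ and the reflection $i\mapsto n+1-i$); for a sequence $x=(x_1,\dots,x_n)$ and $\sigma\in D_n$ put $x^\sigma=(x_{\sigma(1)},\dots,x_{\sigma(n)})$, i.e. a cyclic rotation of $x$ or of its reversal. For tuples $x,y$ of the same length $n$, $x\sim y$ means there is $\sigma\in D_n$ with $x=y^\sigma$. -}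

module Defs where

open import Level using (Level; _⊔_)
open import Algebra.Bundles using (CommutativeRing)
open import Data.Bool using (Bool; true; false; if_then_else_)
open import Data.Nat using (ℕ; zero; suc)
open import Data.Nat.DivMod using (_mod_)
open import Data.Fin using (Fin; toℕ; opposite)
open import Data.List using (List; []; _∷_; _++_; length; tabulate; lookup)
open import Data.List.Relation.Binary.Pointwise using (Pointwise)
open import Data.Product using (_×_; _,_; Σ)
open import Data.Sign using (Sign)

-- Dihedral group D_n acting on positions {0,…,n-1} (0-based version of
-- {1,…,n}).  An element is (s , r): s = true means first apply the
-- reflection i ↦ n-1-i (0-based form of i ↦ n+1-i), then the rotation
-- i ↦ i + r (mod n).  These 2n maps are exactly the elements of D_n.

D : ℕ → Set
D n = Bool × Fin n

perm : ∀ {n} → D n → Fin n → Fin n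
perm {zero}  _       i = i
perm {suc n} (s , r) i =
  (toℕ (if s then opposite i else i) Data.Nat.+ toℕ r) mod suc n

_^_ : ∀ {a} {A : Set a} (x : List A) → D (length x) → List A
x ^ σ = tabulate (λ i → lookup x (perm σ i))

module Quiddity {c ℓ} (A : CommutativeRing c ℓ) where
  open CommutativeRing A

  record M2 : Set c where
    constructor mat
    field
      m11 m12 m21 m22 : Carrier

  _⊗_ : M2 → M2 → M2
  mat a b c' d ⊗ mat e f g h =
    mat (a * e + b * g) (a * f + b * h) (c' * e + d * g) (c' * f + d * h)

  idM : M2
  idM = mat 1# 0# 0# 1#

  _≈M_ : M2 → M2 → Set ℓ
  mat a b c' d ≈M mat e f g h = (a ≈ e) × (b ≈ f) × (c' ≈ g) × (d ≈ h)

  η : Carrier → M2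
  η x = mat x (- 1#) 1# 0#

  prodη : List Carrier → M2
  prodη []       = idM
  prodη (x ∷ xs) = η x ⊗ prodη xs

  -- μ ∈ {±1}, represented by a sign
  signVal : Sign → Carrier
  signVal Sign.+ = 1#
  signVal Sign.- = - 1#

  scal : Carrier → M2 → M2
  scal s (mat a b c' d) = mat (s * a) (s * b) (s * c') (s * d)

  IsQuiddityCycle : Sign → List Carrier → Set ℓ
  IsQuiddityCycle μ xs = prodη xs ≈M scal (signVal μ) idM

  lastOr : Carrier → List Carrier → Carrier
  lastOr d []       = d
  lastOr d (x ∷ xs) = lastOr x xs

  dropLast : List Carrier → List Carrier
  dropLast []           = []
  dropLast (x ∷ [])     = []
  dropLast (x ∷ y ∷ ys) = x ∷ dropLast (y ∷ ys)

  -- a ⊕ b = (a₁+b_l, a₂,…,a_{k-1}, a_k+b₁, b₂,…,b_{l-1}); only meaningful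
  -- for k,l ≥ 2 (other cases: arbitrary junk value, never used)
  _⊕_ : List Carrier → List Carrier → List Carrier
  (a₁ ∷ as@(_ ∷ _)) ⊕ (b₁ ∷ bs@(_ ∷ _)) =
    (a₁ + lastOr b₁ bs) ∷ (dropLast as ++ ((lastOr a₁ as + b₁) ∷ dropLast bs))
  _ ⊕ _ = []

  _≋_ : List Carrier → List Carrier → Set (c ⊔ ℓ)
  _≋_ = Pointwise _≈_

  _∼_ : List Carrier → List Carrier → Set (c ⊔ ℓ)
  x ∼ y = Σ (D (length y)) λ σ → x ≋ (y ^ σ)

module Submission where

-- Write a sequence of length at least 2 as ⟪ x , xs , y ⟫ (first entry, interior, last entry).  Then
-- ⟪ a₁ , as , aₖ ⟫ ⊕ ⟪ b₁ , bs , bₗ ⟫ = (a₁ + bₗ) ∷ as ++ (aₖ + b₁) ∷ bs: two polygons are glued along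
-- an edge and the corners at that edge are added.  In this normal form b ⊕ a is visibly a rotation
-- of a ⊕ b, which gives (1), and (2) is a rearrangement.  For (3), the rotation σ cuts b ⊕ c either
-- inside the block coming from b or inside the one coming from c; in the first case c sits in an edge
-- (p, q) of a rotation b′ of b, and gluing a to the boundary edge of b′ agrees, up to rotation, with
-- gluing c to the rotation of a ⊕ b′ whose boundary edge is (p, q).  A reflecting σ is absorbed by
-- reversing c, since w ⊕ reverse c is dihedrally equivalent to reverse w ⊕ c.  For (4), a μ-quiddity
-- cycle ⟪ x , xs , y ⟫ satisfies η x · P · η y = μ id with P the product over xs, which determines
-- the ends: y = μ P₁₂ and x = - μ P₂₁.  If a ⊕ b = b ⊕ a and |a| = |b|, the interiors of a and b
-- agree, hence so do their ends.  Only (4) uses the quiddity hypotheses.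

open import Defs
open import Algebra.Bundles using (CommutativeRing)
open import Data.Bool using (true; false)
open import Data.Nat using (ℕ; _<_; _≤_; NonZero; zero; suc; z<s; s<s; s≤s; s≤s⁻¹; _<?_)
open import Data.Nat.DivMod using (m%n<n; m<n⇒m%n≡m; [m+n]%n≡m%n)
open import Data.Nat.Properties
  using (≮⇒≥; <⇒≱; <⇒≤; <-≤-trans; <-cmp; m≤n⇒∃[o]m+o≡n; +-cancelˡ-<; +-monoˡ-<; m∸n+n≡m; +-∸-assoc; n∸n≡0;
         m<m+n; suc-injective; +-cancelʳ-≡)
open import Data.Fin using (Fin; toℕ; opposite; fromℕ<) renaming (zero to fzero; suc to fsuc)
open import Data.Fin.Properties using (toℕ<n; toℕ-fromℕ<; opposite-prop)
open import Data.List using (List; []; _∷_; _++_; [_]; length; reverse; drop; take; tabulate; lookup; initLast; _∷ʳ′_)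
open import Data.List.Properties
  using (length-++; length-drop; length-reverse; length-tabulate; length-++-comm; length-++-sucʳ;
         unfold-reverse; reverse-++; reverse-involutive; take++drop≡id; ∷-injective; ++-identityʳ; ++-assoc; ++-monoid)
open import Data.List.Relation.Binary.Pointwise using (tail)
open import Data.List.Relation.Unary.All using (All)
open import Data.Product using (_×_; Σ; _,_; proj₁; proj₂; ∃-syntax; ∃₂)
open import Data.Sign using (Sign)
open import Data.Sum using (_⊎_; inj₁; inj₂)
open import Function using (_∘_)
open import Relation.Binary.Bundles using (Setoid)
open import Relation.Binary.Definitions using (tri<; tri≈; tri>)
open import Relation.Binary.PropositionalEquality
  using (_≡_; refl; sym; trans; cong; cong₂; subst; module ≡-Reasoning)
open import Relation.Nullary using (yes; no; contradiction)
import Algebra.Properties.Ring as RingProperties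
import Algebra.Solver.Monoid as MonoidSolver
import Algebra.Solver.Ring.NaturalCoefficients.Default as NaturalSolver
import Data.List.Relation.Binary.Equality.Setoid as SetoidEquality
import Relation.Binary.Reasoning.Setoid as SetoidReasoning

module _ {a} {X : Set a} where
  open import Data.Nat using (_+_; _∸_; _%_)
  open import Data.Nat.Properties using (+-comm; +-assoc; +-identityʳ)

  -- A default value and a natural-number index keep the index arithmetic of perm (modulo n) in ℕ.
  lookupOr : X → List X → ℕ → X
  lookupOr d []       _       = d
  lookupOr d (x ∷ xs) zero    = x
  lookupOr d (x ∷ xs) (suc j) = lookupOr d xs j

  lookup≡lookupOr : ∀ d xs (i : Fin (length xs)) → lookup xs i ≡ lookupOr d xs (toℕ i)
  lookup≡lookupOr d (x ∷ xs) fzero    = refl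
  lookup≡lookupOr d (x ∷ xs) (fsuc i) = lookup≡lookupOr d xs i

  lookupOr-tabulate : ∀ d {n} (f : Fin n → X) i → lookupOr d (tabulate f) (toℕ i) ≡ f i
  lookupOr-tabulate d f fzero    = refl
  lookupOr-tabulate d f (fsuc i) = lookupOr-tabulate d (f ∘ fsuc) i

  lookupOr-++ˡ : ∀ d xs ys {j} → j < length xs → lookupOr d (xs ++ ys) j ≡ lookupOr d xs j
  lookupOr-++ˡ d (x ∷ xs) ys {zero}  _       = refl
  lookupOr-++ˡ d (x ∷ xs) ys {suc j} (s≤s p) = lookupOr-++ˡ d xs ys p

  lookupOr-++ʳ : ∀ d xs ys j → lookupOr d (xs ++ ys) (length xs + j) ≡ lookupOr d ys j
  lookupOr-++ʳ d []       ys j = refl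
  lookupOr-++ʳ d (x ∷ xs) ys j = lookupOr-++ʳ d xs ys j

  lookupOr-drop : ∀ d t xs j → lookupOr d (drop t xs) j ≡ lookupOr d xs (t + j)
  lookupOr-drop d zero    xs       j = refl
  lookupOr-drop d (suc t) []       j = refl
  lookupOr-drop d (suc t) (x ∷ xs) j = lookupOr-drop d t xs j

  lookupOr-take : ∀ d t xs {j} → j < t → lookupOr d (take t xs) j ≡ lookupOr d xs j
  lookupOr-take d (suc t) []       _       = refl
  lookupOr-take d (suc t) (x ∷ xs) {zero}  _       = refl
  lookupOr-take d (suc t) (x ∷ xs) {suc j} (s≤s p) = lookupOr-take d t xs p

  lookupOr-reverse : ∀ d xs {j} → j < length xs →
                     lookupOr d (reverse xs) j ≡ lookupOr d xs (length xs ∸ suc j)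
  lookupOr-reverse d (x ∷ xs) {j} j<1+n rewrite unfold-reverse x xs with <-cmp j (length xs)
  ... | tri< j<n _ _ = begin
    lookupOr d (reverse xs ++ [ x ]) j
      ≡⟨ lookupOr-++ˡ d (reverse xs) [ x ] (subst (j <_) (sym (length-reverse xs)) j<n) ⟩
    lookupOr d (reverse xs) j                 ≡⟨ lookupOr-reverse d xs j<n ⟩
    lookupOr d (x ∷ xs) (suc (length xs ∸ suc j)) ≡⟨ cong (lookupOr d (x ∷ xs)) (+-∸-assoc 1 j<n) ⟨
    lookupOr d (x ∷ xs) (length xs ∸ j)       ∎
    where open ≡-Reasoning
  ... | tri≈ _ refl _ = begin
    lookupOr d (reverse xs ++ [ x ]) (length xs)
      ≡⟨ cong (lookupOr d (reverse xs ++ [ x ])) (trans (+-identityʳ _) (length-reverse xs)) ⟨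
    lookupOr d (reverse xs ++ [ x ]) (length (reverse xs) + 0)  ≡⟨ lookupOr-++ʳ d (reverse xs) [ x ] 0 ⟩
    x                                                            ≡⟨ cong (lookupOr d (x ∷ xs)) (n∸n≡0 (length xs)) ⟨
    lookupOr d (x ∷ xs) (length xs ∸ length xs)                  ∎
    where open ≡-Reasoning
  ... | tri> _ _ j>n = contradiction (s≤s⁻¹ j<1+n) (<⇒≱ j>n)

  ≡-tabulate : ∀ d xs {n} (f : Fin n → X) → length xs ≡ n →
               (∀ i → lookupOr d xs (toℕ i) ≡ f i) → xs ≡ tabulate f
  ≡-tabulate d []       {zero}  f _  _ = refl
  ≡-tabulate d (x ∷ xs) {suc n} f eq h =
    cong₂ _∷_ (h fzero) (≡-tabulate d xs (f ∘ fsuc) (suc-injective eq) (h ∘ fsuc))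

  lookupOr-rotate : ∀ d xs t {i} .{{_ : NonZero (length xs)}} → t ≤ length xs → i < length xs →
                    lookupOr d (drop t xs ++ take t xs) i ≡ lookupOr d xs ((i + t) % length xs)
  lookupOr-rotate d xs t {i} t≤n i<n with i <? length (drop t xs)
  ... | yes i<m = begin
    lookupOr d (drop t xs ++ take t xs) i  ≡⟨ lookupOr-++ˡ d (drop t xs) (take t xs) i<m ⟩
    lookupOr d (drop t xs) i               ≡⟨ lookupOr-drop d t xs i ⟩
    lookupOr d xs (t + i)                  ≡⟨ cong (lookupOr d xs) (trans (+-comm t i) (sym (m<n⇒m%n≡m i+t<n))) ⟩
    lookupOr d xs ((i + t) % length xs)    ∎
    where
    open ≡-Reasoning
    i+t<n : i + t < length xs
    i+t<n = subst (i + t <_) (trans (cong (_+ t) (length-drop t xs)) (m∸n+n≡m t≤n)) (+-monoˡ-< t i<m)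
  ... | no i≮m with m≤n⇒∃[o]m+o≡n (≮⇒≥ i≮m)
  ... | e , refl = begin
    lookupOr d (drop t xs ++ take t xs) (m + e)  ≡⟨ lookupOr-++ʳ d (drop t xs) (take t xs) e ⟩
    lookupOr d (take t xs) e                     ≡⟨ lookupOr-take d t xs e<t ⟩
    lookupOr d xs e                              ≡⟨ cong (lookupOr d xs) [m+e+t]%n≡e ⟨
    lookupOr d xs ((m + e + t) % length xs)      ∎
    where
    open ≡-Reasoning
    m = length (drop t xs)
    m+t≡n : m + t ≡ length xs
    m+t≡n = trans (cong (_+ t) (length-drop t xs)) (m∸n+n≡m t≤n)
    e<t : e < t
    e<t = +-cancelˡ-< m e t (subst (m + e <_) (sym m+t≡n) i<n)
    [m+e+t]%n≡e : (m + e + t) % length xs ≡ e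
    [m+e+t]%n≡e = begin
      (m + e + t) % length xs    ≡⟨ cong (λ k → (k + t) % length xs) (+-comm m e) ⟩
      (e + m + t) % length xs    ≡⟨ cong (_% length xs) (trans (+-assoc e m t) (cong (e +_) m+t≡n)) ⟩
      (e + length xs) % length xs ≡⟨ [m+n]%n≡m%n e (length xs) ⟩
      e % length xs              ≡⟨ m<n⇒m%n≡m (<-≤-trans e<t t≤n) ⟩
      e                          ∎

  tabulate-opposite : ∀ {n} (f : Fin n → X) → tabulate (f ∘ opposite) ≡ reverse (tabulate f)
  tabulate-opposite {zero}  f = refl
  tabulate-opposite {suc n} f = sym (≡-tabulate (f fzero) (reverse (tabulate f)) (f ∘ opposite)
    (trans (length-reverse (tabulate f)) (length-tabulate f)) λ i → begin
      lookupOr d (reverse (tabulate f)) (toℕ i)                      ≡⟨ lookupOr-reverse d (tabulate f) i<len ⟩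
      lookupOr d (tabulate f) (length (tabulate f) ∸ suc (toℕ i))
        ≡⟨ cong (λ m → lookupOr d (tabulate f) (m ∸ suc (toℕ i))) (length-tabulate f) ⟩
      lookupOr d (tabulate f) (suc n ∸ suc (toℕ i))                 ≡⟨ cong (lookupOr d (tabulate f)) (opposite-prop i) ⟨
      lookupOr d (tabulate f) (toℕ (opposite i))                    ≡⟨ lookupOr-tabulate d f (opposite i) ⟩
      f (opposite i)                                                ∎)
    where
    open ≡-Reasoning
    d = f fzero
    i<len : ∀ {i : Fin (suc n)} → toℕ i < length (tabulate f)
    i<len {i} = subst (toℕ i <_) (sym (length-tabulate f)) (toℕ<n i)

  ^-rotate : ∀ (xs : List X) r → xs ^ (false , r) ≡ drop (toℕ r) xs ++ take (toℕ r) xs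
  ^-rotate xs@(x ∷ _) r = sym (≡-tabulate x (drop t xs ++ take t xs) _ length-rotated λ i → begin
    lookupOr x (drop t xs ++ take t xs) (toℕ i)   ≡⟨ lookupOr-rotate x xs t (<⇒≤ (toℕ<n r)) (toℕ<n i) ⟩
    lookupOr x xs ((toℕ i + t) % length xs)       ≡⟨ cong (lookupOr x xs) (toℕ-fromℕ< (m%n<n (toℕ i + t) (length xs))) ⟨
    lookupOr x xs (toℕ (perm (false , r) i))      ≡⟨ lookup≡lookupOr x xs (perm (false , r) i) ⟨
    lookup xs (perm (false , r) i)                ∎)
    where
    open ≡-Reasoning
    t = toℕ r
    length-rotated : length (drop t xs ++ take t xs) ≡ length xs
    length-rotated = trans (length-++-comm (drop t xs) _) (cong length (take++drop≡id t xs))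

  ^-reflect : ∀ (xs : List X) r → xs ^ (true , r) ≡ reverse (drop (toℕ r) xs ++ take (toℕ r) xs)
  ^-reflect xs@(_ ∷ _) r =
    trans (tabulate-opposite (λ i → lookup xs (perm (false , r) i))) (cong reverse (^-rotate xs r))

  1<length-^ : ∀ (xs : List X) σ → 1 < length xs → 1 < length (xs ^ σ)
  1<length-^ xs σ 1<n = subst (1 <_) (sym (length-tabulate (λ i → lookup xs (perm σ i)))) 1<n

  ++-≡-++ : ∀ (ws xs ys zs : List X) → ws ++ xs ≡ ys ++ zs →
            (∃[ ms ] ys ≡ ws ++ ms × xs ≡ ms ++ zs) ⊎ (∃[ ms ] ws ≡ ys ++ ms × zs ≡ ms ++ xs)
  ++-≡-++ []       xs ys       zs eq = inj₁ (ys , refl , eq)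
  ++-≡-++ (w ∷ ws) xs []       zs eq = inj₂ (w ∷ ws , refl , sym eq)
  ++-≡-++ (w ∷ ws) xs (y ∷ ys) zs eq with ∷-injective eq
  ... | refl , eq′ with ++-≡-++ ws xs ys zs eq′
  ... | inj₁ (ms , p , q) = inj₁ (ms , cong (w ∷_) p , q)
  ... | inj₂ (ms , p , q) = inj₂ (ms , cong (w ∷_) p , q)

  take-length-++ : ∀ (xs ys : List X) → take (length xs) (xs ++ ys) ≡ xs
  take-length-++ []       ys = refl
  take-length-++ (x ∷ xs) ys = cong (x ∷_) (take-length-++ xs ys)

  drop-length-++ : ∀ (xs ys : List X) → drop (length xs) (xs ++ ys) ≡ ys
  drop-length-++ []       ys = refl
  drop-length-++ (x ∷ xs) ys = drop-length-++ xs ys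

  rotation-index : ∀ (xs ys : List X) → 0 < length (xs ++ ys) →
                   ∃[ r ] drop (toℕ {length (xs ++ ys)} r) (xs ++ ys) ++ take (toℕ r) (xs ++ ys) ≡ ys ++ xs
  rotation-index xs [] 0<n = fromℕ< 0<n ,
    trans (cong (λ t → drop t (xs ++ []) ++ take t (xs ++ [])) (toℕ-fromℕ< 0<n))
          (trans (++-identityʳ (xs ++ [])) (++-identityʳ xs))
  rotation-index xs ys@(_ ∷ _) _ = fromℕ< xs<n ,
    trans (cong (λ t → drop t (xs ++ ys) ++ take t (xs ++ ys)) (toℕ-fromℕ< xs<n))
          (cong₂ _++_ (drop-length-++ xs ys) (take-length-++ xs ys))
    where
    xs<n : length xs < length (xs ++ ys)
    xs<n = subst (length xs <_) (sym (length-++ xs)) (m<m+n (length xs) z<s)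

  rotation-cases : ∀ u (bs : List X) v cs ps ss → ps ++ ss ≡ u ∷ bs ++ v ∷ cs →
    (∃₂ λ bs₁ bs₂ → bs ≡ bs₁ ++ bs₂ × ss ++ ps ≡ bs₂ ++ v ∷ cs ++ u ∷ bs₁) ⊎
    (∃₂ λ cs₁ cs₂ → cs ≡ cs₁ ++ cs₂ × ss ++ ps ≡ cs₂ ++ u ∷ bs ++ v ∷ cs₁)
  rotation-cases u bs v cs ps ss eq with ++-≡-++ ps ss (u ∷ bs) (v ∷ cs) eq
  rotation-cases u bs v cs []       ss _ | inj₁ (ms , refl , ss≡) =
    inj₂ (cs , [] , sym (++-identityʳ cs) , trans (++-identityʳ ss) ss≡)
  rotation-cases u bs v cs (p ∷ ps) ss _ | inj₁ (ms , refl , refl) =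
    inj₁ (ps , ms , refl , ++-assoc ms (v ∷ cs) (u ∷ ps))
  rotation-cases u bs v cs ps ss _ | inj₂ ([] , refl , refl) =
    inj₁ (bs , [] , sym (++-identityʳ bs) , cong (λ us → v ∷ cs ++ u ∷ us) (++-identityʳ bs))
  rotation-cases u bs v cs ps ss _ | inj₂ (m ∷ ms , refl , refl) =
    inj₂ (ms , ss , refl , refl)

  reverse-++-∷ : ∀ (xs : List X) y ys → reverse (xs ++ y ∷ ys) ≡ reverse ys ++ y ∷ reverse xs
  reverse-++-∷ xs y ys = begin
    reverse (xs ++ y ∷ ys)            ≡⟨ reverse-++ xs (y ∷ ys) ⟩
    reverse (y ∷ ys) ++ reverse xs    ≡⟨ cong (_++ reverse xs) (unfold-reverse y ys) ⟩
    (reverse ys ++ [ y ]) ++ reverse xs ≡⟨ ++-assoc (reverse ys) [ y ] (reverse xs) ⟩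
    reverse ys ++ y ∷ reverse xs      ∎
    where open ≡-Reasoning

  reverse-++-∷-++-∷ : ∀ (xs : List X) u ys v zs →
                      reverse (xs ++ u ∷ ys ++ v ∷ zs) ≡ reverse zs ++ v ∷ reverse ys ++ u ∷ reverse xs
  reverse-++-∷-++-∷ xs u ys v zs = trans (reverse-++-∷ xs u (ys ++ v ∷ zs))
    (trans (cong (_++ u ∷ reverse xs) (reverse-++-∷ ys v zs)) (++-assoc (reverse zs) (v ∷ reverse ys) (u ∷ reverse xs)))

module Dihedral {c ℓ} (S : Setoid c ℓ) where
  open Setoid S using () renaming (Carrier to X)
  open SetoidEquality S using (_≋_; []; _∷_; ≋-length; ≋-refl; ≋-reflexive; ≋-trans; ++⁺; reverse⁺)

  Rotated : List X → List X → Set _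
  Rotated xs ys = ∃₂ λ ys₁ ys₂ → ys ≡ ys₁ ++ ys₂ × xs ≋ ys₂ ++ ys₁

  infix 4 _≅_
  _≅_ : List X → List X → Set _
  xs ≅ ys = Rotated xs ys ⊎ Rotated (reverse xs) ys

  ≋⇒Rotated : ∀ {xs ys} → xs ≋ ys → Rotated xs ys
  ≋⇒Rotated {ys = ys} xs≋ys = ys , [] , sym (++-identityʳ ys) , xs≋ys

  ≋-++-split : ∀ us {vs ws} → us ++ vs ≋ ws → ∃₂ λ ws₁ ws₂ → ws ≡ ws₁ ++ ws₂ × us ≋ ws₁ × vs ≋ ws₂
  ≋-++-split []       vs≋ = [] , _ , refl , [] , vs≋
  ≋-++-split (u ∷ us) (u≈ ∷ rest) with ≋-++-split us rest
  ... | ws₁ , ws₂ , refl , us≋ , vs≋ = _ ∷ ws₁ , ws₂ , refl , u≈ ∷ us≋ , vs≋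

  Rotated-trans : ∀ {xs ys zs} → Rotated xs ys → Rotated ys zs → Rotated xs zs
  Rotated-trans (ys₁ , ys₂ , refl , xs≋) (zs₁ , zs₂ , refl , ys≋) with ≋-++-split ys₁ ys≋
  ... | ws₁ , ws₂ , eq , ys₁≋ , ys₂≋ with ++-≡-++ ws₁ ws₂ zs₂ zs₁ (sym eq)
  ... | inj₁ (ms , refl , refl) = zs₁ ++ ws₁ , ms , sym (++-assoc zs₁ ws₁ ms) ,
          ≋-trans xs≋ (≋-trans (++⁺ ys₂≋ ys₁≋) (≋-reflexive (++-assoc ms zs₁ ws₁)))
  ... | inj₂ (ms , refl , refl) = ms , ws₂ ++ zs₂ , ++-assoc ms ws₂ zs₂ ,
          ≋-trans xs≋ (≋-trans (++⁺ ys₂≋ ys₁≋) (≋-reflexive (sym (++-assoc ws₂ zs₂ ms))))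

  Rotated-reverse : ∀ {xs ys} → Rotated xs ys → Rotated (reverse xs) (reverse ys)
  Rotated-reverse (ys₁ , ys₂ , refl , xs≋) = reverse ys₂ , reverse ys₁ , reverse-++ ys₁ ys₂ ,
    ≋-trans (reverse⁺ xs≋) (≋-reflexive (reverse-++ ys₂ ys₁))

  ≅-length : ∀ {xs ys} → xs ≅ ys → length xs ≡ length ys
  ≅-length (inj₁ (ys₁ , ys₂ , refl , xs≋)) = trans (≋-length xs≋) (length-++-comm ys₂ ys₁)
  ≅-length {xs} (inj₂ (ys₁ , ys₂ , refl , xs≋)) =
    trans (sym (length-reverse xs)) (trans (≋-length xs≋) (length-++-comm ys₂ ys₁))

  ≅-trans : ∀ {xs ys zs} → xs ≅ ys → ys ≅ zs → xs ≅ zs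
  ≅-trans (inj₁ xy) (inj₁ yz) = inj₁ (Rotated-trans xy yz)
  ≅-trans (inj₁ xy) (inj₂ yz) = inj₂ (Rotated-trans (Rotated-reverse xy) yz)
  ≅-trans (inj₂ xy) (inj₁ yz) = inj₂ (Rotated-trans xy yz)
  ≅-trans {xs} {ys} (inj₂ xy) (inj₂ yz) =
    inj₁ (Rotated-trans (subst (λ us → Rotated us (reverse ys)) (reverse-involutive xs) (Rotated-reverse xy)) yz)

  ≋⇒≅ : ∀ {xs ys} → xs ≋ ys → xs ≅ ys
  ≋⇒≅ xs≋ys = inj₁ (≋⇒Rotated xs≋ys)

  ≡⇒≅ : ∀ {xs ys} → xs ≡ ys → xs ≅ ys
  ≡⇒≅ refl = ≋⇒≅ ≋-refl

  rotate-≅ : ∀ xs ys → ys ++ xs ≅ xs ++ ys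
  rotate-≅ xs ys = inj₁ (xs , ys , refl , ≋-refl)

  reverse-≅ : ∀ xs → reverse xs ≅ xs
  reverse-≅ xs = inj₂ (≋⇒Rotated (≋-reflexive (reverse-involutive xs)))

  ≅⇒dihedral : ∀ {xs ys} → xs ≅ ys → 0 < length ys → Σ (D (length ys)) λ σ → xs ≋ ys ^ σ
  ≅⇒dihedral (inj₁ (ys₁ , ys₂ , refl , xs≋)) 0<n with rotation-index ys₁ ys₂ 0<n
  ... | r , eq = (false , r) , ≋-trans xs≋ (≋-reflexive (sym (trans (^-rotate (ys₁ ++ ys₂) r) eq)))
  ≅⇒dihedral {xs} (inj₂ (ys₁ , ys₂ , refl , xs≋)) 0<n with rotation-index ys₁ ys₂ 0<n
  ... | r , eq = (true , r) , ≋-trans (≋-reflexive (sym (reverse-involutive xs)))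
        (≋-trans (reverse⁺ xs≋) (≋-reflexive (sym (trans (^-reflect (ys₁ ++ ys₂) r) (cong reverse eq)))))

module Gluing {r ℓ} (R : CommutativeRing r ℓ) where
  open CommutativeRing R renaming (refl to ≈-refl; sym to ≈-sym; trans to ≈-trans)
  open Quiddity R
  open Dihedral setoid
  open MonoidSolver (++-monoid Carrier) using (_⊜_) renaming (solve to ++-solve; _⊕_ to _⊹_)
  open SetoidEquality setoid
    using ([]; _∷_; ≋-refl; ≋-reflexive; ≋-trans; ++⁺; ≋-setoid)

  ⟪_,_,_⟫ : Carrier → List Carrier → Carrier → List Carrier
  ⟪ x , xs , y ⟫ = x ∷ xs ++ [ y ]

  lastOr-∷ʳ : ∀ d xs y → lastOr d (xs ++ [ y ]) ≡ y
  lastOr-∷ʳ d []       y = refl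
  lastOr-∷ʳ d (x ∷ xs) y = lastOr-∷ʳ x xs y

  dropLast-∷ʳ : ∀ xs y → dropLast (xs ++ [ y ]) ≡ xs
  dropLast-∷ʳ []           y = refl
  dropLast-∷ʳ (x ∷ [])     y = refl
  dropLast-∷ʳ (x ∷ x′ ∷ xs) y = cong (x ∷_) (dropLast-∷ʳ (x′ ∷ xs) y)

  -- _⊕_ only computes once both arguments are visibly of length at least 2.
  ⊕-⟪⟫-unfold : ∀ a₁ as aₖ b₁ bs bₗ → ⟪ a₁ , as , aₖ ⟫ ⊕ ⟪ b₁ , bs , bₗ ⟫ ≡
    (a₁ + lastOr b₁ (bs ++ [ bₗ ])) ∷ dropLast (as ++ [ aₖ ]) ++ (lastOr a₁ (as ++ [ aₖ ]) + b₁) ∷ dropLast (bs ++ [ bₗ ])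
  ⊕-⟪⟫-unfold _ []      _ _ []      _ = refl
  ⊕-⟪⟫-unfold _ []      _ _ (_ ∷ _) _ = refl
  ⊕-⟪⟫-unfold _ (_ ∷ _) _ _ []      _ = refl
  ⊕-⟪⟫-unfold _ (_ ∷ _) _ _ (_ ∷ _) _ = refl

  ⊕-⟪⟫ : ∀ a₁ as aₖ b₁ bs bₗ → ⟪ a₁ , as , aₖ ⟫ ⊕ ⟪ b₁ , bs , bₗ ⟫ ≡ (a₁ + bₗ) ∷ as ++ (aₖ + b₁) ∷ bs
  ⊕-⟪⟫ a₁ as aₖ b₁ bs bₗ rewrite ⊕-⟪⟫-unfold a₁ as aₖ b₁ bs bₗ
    | lastOr-∷ʳ b₁ bs bₗ | lastOr-∷ʳ a₁ as aₖ | dropLast-∷ʳ as aₖ | dropLast-∷ʳ bs bₗ = refl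

  lastOr-cong : ∀ {d d′ xs xs′} → d ≈ d′ → xs ≋ xs′ → lastOr d xs ≈ lastOr d′ xs′
  lastOr-cong d≈ []          = d≈
  lastOr-cong _  (x≈ ∷ xs≋) = lastOr-cong x≈ xs≋

  dropLast-cong : ∀ {xs xs′} → xs ≋ xs′ → dropLast xs ≋ dropLast xs′
  dropLast-cong []                = []
  dropLast-cong (_  ∷ [])         = []
  dropLast-cong (x≈ ∷ x≈′ ∷ xs≋) = x≈ ∷ dropLast-cong (x≈′ ∷ xs≋)

  ⊕-cong : ∀ {xs xs′ ys ys′} → xs ≋ xs′ → ys ≋ ys′ → (xs ⊕ ys) ≋ (xs′ ⊕ ys′)
  ⊕-cong []                _                 = []
  ⊕-cong (_ ∷ [])          _                 = []
  ⊕-cong (_ ∷ _ ∷ _)       []                = []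
  ⊕-cong (_ ∷ _ ∷ _)       (_ ∷ [])          = []
  ⊕-cong (x≈ ∷ x≈′ ∷ xs≋) (y≈ ∷ y≈′ ∷ ys≋) =
    +-cong x≈ (lastOr-cong y≈ (y≈′ ∷ ys≋)) ∷
    ++⁺ (dropLast-cong (x≈′ ∷ xs≋)) (+-cong (lastOr-cong x≈ (x≈′ ∷ xs≋)) y≈ ∷ dropLast-cong (y≈′ ∷ ys≋))

  framed : ∀ xs → 1 < length xs → ∃₂ λ x ys → ∃[ y ] xs ≡ ⟪ x , ys , y ⟫
  framed (x ∷ xs) (s<s 0<n) with initLast xs | 0<n
  ... | ys ∷ʳ′ y | _ = x , ys , y , refl

  1<length-⟪⟫ : ∀ x xs y → 1 < length ⟪ x , xs , y ⟫
  1<length-⟪⟫ x xs y = s<s (subst (0 <_) (sym (length-++-sucʳ xs y [])) z<s)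

  1<length-⊕ : ∀ xs ys → 1 < length xs → 1 < length ys → 1 < length (xs ⊕ ys)
  1<length-⊕ (_ ∷ x ∷ xs) (_ ∷ _ ∷ _) _        _        = s<s (subst (0 <_) (sym (length-++-sucʳ (dropLast (x ∷ xs)) _ _)) z<s)
  1<length-⊕ (_ ∷ _ ∷ _)  (_ ∷ [])    _        (s<s ())
  1<length-⊕ (_ ∷ [])     (_ ∷ _ ∷ _) (s<s ()) _

  ≅⇒∼ : ∀ {xs ys} → xs ≅ ys → 1 < length ys → xs ∼ ys
  ≅⇒∼ xs≅ys 1<n = ≅⇒dihedral xs≅ys (<⇒≤ 1<n)

  ⊕-assoc-∼ : ∀ a₁ as aₖ b₁ bs bₗ c₁ cs cₘ →
    let a = ⟪ a₁ , as , aₖ ⟫; b = ⟪ b₁ , bs , bₗ ⟫; c = ⟪ c₁ , cs , cₘ ⟫ in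
    2 < length b →
    Σ (D (length b)) λ τ → Σ (D (length ((b ^ τ) ⊕ c))) λ σ → ((a ⊕ b) ⊕ c) ≋ (a ⊕ (((b ^ τ) ⊕ c) ^ σ))
  ⊕-assoc-∼ a₁ as aₖ b₁ bs bₗ c₁ cs cₘ 2<b with initLast bs | 2<b
  ... | []        | s<s (s<s ())
  ... | bs ∷ʳ′ β  | _ = τ , σ , (begin
    (a ⊕ b) ⊕ c                                          ≡⟨ cong (_⊕ c) a⊕b≡ ⟩
    ⟪ a₁ + bₗ , as ++ (aₖ + b₁) ∷ bs , β ⟫ ⊕ c           ≡⟨ ⊕-⟪⟫ (a₁ + bₗ) (as ++ (aₖ + b₁) ∷ bs) β c₁ cs cₘ ⟩
    (a₁ + bₗ + cₘ) ∷ (as ++ (aₖ + b₁) ∷ bs) ++ (β + c₁) ∷ cs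
      ≈⟨ +-assoc a₁ bₗ cₘ ∷ ≋-reflexive (++-assoc as ((aₖ + b₁) ∷ bs) _) ⟩
    (a₁ + (bₗ + cₘ)) ∷ as ++ (aₖ + b₁) ∷ bs ++ (β + c₁) ∷ cs ≡⟨ ⊕-⟪⟫ a₁ as aₖ b₁ (bs ++ (β + c₁) ∷ cs) (bₗ + cₘ) ⟨
    a ⊕ z                                                 ≈⟨ ⊕-cong (≋-refl {a}) z≋ ⟩
    a ⊕ (((b ^ τ) ⊕ c) ^ σ)                               ∎)
    where
    open SetoidReasoning ≋-setoid
    a = ⟪ a₁ , as , aₖ ⟫
    b = ⟪ b₁ , bs ++ [ β ] , bₗ ⟫
    c = ⟪ c₁ , cs , cₘ ⟫
    a⊕b≡ : a ⊕ b ≡ ⟪ a₁ + bₗ , as ++ (aₖ + b₁) ∷ bs , β ⟫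
    a⊕b≡ = trans (⊕-⟪⟫ a₁ as aₖ b₁ (bs ++ [ β ]) bₗ) (cong ((a₁ + bₗ) ∷_) (sym (++-assoc as ((aₖ + b₁) ∷ bs) [ β ])))
    b′ = ⟪ bₗ , b₁ ∷ bs , β ⟫
    τb′ = ≅⇒∼ (rotate-≅ (b₁ ∷ bs ++ [ β ]) [ bₗ ]) (1<length-⟪⟫ b₁ (bs ++ [ β ]) bₗ)
    τ = proj₁ τb′
    z = ⟪ b₁ , bs ++ (β + c₁) ∷ cs , bₗ + cₘ ⟫
    z≅ : z ≅ (b ^ τ) ⊕ c
    z≅ = ≅-trans (rotate-≅ [ bₗ + cₘ ] (b₁ ∷ bs ++ (β + c₁) ∷ cs))
          (≋⇒≅ (≋-trans (≋-reflexive (sym (⊕-⟪⟫ bₗ (b₁ ∷ bs) β c₁ cs cₘ))) (⊕-cong (proj₂ τb′) ≋-refl)))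
    σz = ≅⇒∼ z≅ (1<length-⊕ (b ^ τ) c (1<length-^ b τ (1<length-⟪⟫ b₁ (bs ++ [ β ]) bₗ)) (1<length-⟪⟫ c₁ cs cₘ))
    σ = proj₁ σz
    z≋ = proj₂ σz

  reverse-⟪⟫ : ∀ x xs y → reverse ⟪ x , xs , y ⟫ ≡ ⟪ y , reverse xs , x ⟫
  reverse-⟪⟫ x xs y = trans (unfold-reverse x (xs ++ [ y ])) (cong (_++ [ x ]) (reverse-++ xs [ y ]))

  rotated-by : ∀ {xs ys} (us vs : List Carrier) → xs ≡ vs ++ us → ys ≡ us ++ vs → xs ≅ ys
  rotated-by us vs refl refl = rotate-≅ us vs

  reversed-by : ∀ {xs ys} (us vs : List Carrier) → reverse xs ≡ vs ++ us → ys ≡ us ++ vs → xs ≅ ys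
  reversed-by us vs eq refl = inj₂ (us , vs , refl , ≋-reflexive eq)

  reverse-⊕-≅ : ∀ ws c₁ cs cₘ → ws ⊕ ⟪ cₘ , reverse cs , c₁ ⟫ ≅ reverse ws ⊕ ⟪ c₁ , cs , cₘ ⟫
  reverse-⊕-≅ []       c₁ cs cₘ = ≋⇒≅ []
  reverse-⊕-≅ (w ∷ ws) c₁ cs cₘ with initLast ws
  ... | []        = ≋⇒≅ []
  ... | vs ∷ʳ′ wₙ
    rewrite reverse-⟪⟫ w vs wₙ | ⊕-⟪⟫ w vs wₙ cₘ (reverse cs) c₁ | ⊕-⟪⟫ wₙ (reverse vs) w c₁ cs cₘ =
    reversed-by ((wₙ + cₘ) ∷ reverse vs ++ [ w + c₁ ]) cs reverse-lhs
      (cong ((wₙ + cₘ) ∷_) (sym (++-assoc (reverse vs) [ w + c₁ ] cs)))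
    where
    open ≡-Reasoning
    reverse-lhs : reverse ((w + c₁) ∷ vs ++ (wₙ + cₘ) ∷ reverse cs) ≡ cs ++ (wₙ + cₘ) ∷ reverse vs ++ [ w + c₁ ]
    reverse-lhs = begin
      reverse ((w + c₁) ∷ vs ++ (wₙ + cₘ) ∷ reverse cs)
        ≡⟨ unfold-reverse (w + c₁) (vs ++ (wₙ + cₘ) ∷ reverse cs) ⟩
      reverse (vs ++ (wₙ + cₘ) ∷ reverse cs) ++ [ w + c₁ ]
        ≡⟨ cong (_++ [ w + c₁ ]) (reverse-++-∷ vs (wₙ + cₘ) (reverse cs)) ⟩
      (reverse (reverse cs) ++ (wₙ + cₘ) ∷ reverse vs) ++ [ w + c₁ ]
        ≡⟨ cong (λ us → (us ++ (wₙ + cₘ) ∷ reverse vs) ++ [ w + c₁ ]) (reverse-involutive cs) ⟩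
      (cs ++ (wₙ + cₘ) ∷ reverse vs) ++ [ w + c₁ ]
        ≡⟨ ++-assoc cs ((wₙ + cₘ) ∷ reverse vs) [ w + c₁ ] ⟩
      cs ++ (wₙ + cₘ) ∷ reverse vs ++ [ w + c₁ ]
        ∎

  Reglued : List Carrier → List Carrier → List Carrier → List Carrier → Set _
  Reglued a b′ c x = ∃[ ws ] ws ≅ a ⊕ b′ × x ≅ ws ⊕ c

  -- In the three cases below, ws is the rotation of a ⊕ b′ whose boundary edge is (p, q).
  ⊕-insert-first : ∀ a₁ as aₖ c₁ cs cₘ p q zs z′ →
    Reglued ⟪ a₁ , as , aₖ ⟫ ⟪ p , q ∷ zs , z′ ⟫ ⟪ c₁ , cs , cₘ ⟫
            (⟪ a₁ , as , aₖ ⟫ ⊕ ((p + c₁) ∷ cs ++ (q + cₘ) ∷ zs ++ [ z′ ]))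
  ⊕-insert-first a₁ as aₖ c₁ cs cₘ p q zs z′ = ws , ws≅ , x≅
    where
    a = ⟪ a₁ , as , aₖ ⟫
    ws = ⟪ q , zs ++ (a₁ + z′) ∷ as , aₖ + p ⟫
    ws≅ : ws ≅ a ⊕ ⟪ p , q ∷ zs , z′ ⟫
    ws≅ = rotated-by ((a₁ + z′) ∷ as ++ [ aₖ + p ]) (q ∷ zs)
      (cong (q ∷_) (++-assoc zs ((a₁ + z′) ∷ as) [ aₖ + p ]))
      (trans (⊕-⟪⟫ a₁ as aₖ p (q ∷ zs) z′) (cong ((a₁ + z′) ∷_) (sym (++-assoc as [ aₖ + p ] (q ∷ zs)))))
    x≅ : a ⊕ ((p + c₁) ∷ cs ++ (q + cₘ) ∷ zs ++ [ z′ ]) ≅ ws ⊕ ⟪ c₁ , cs , cₘ ⟫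
    x≅ = ≅-trans (≋⇒≅ (≋-trans (≋-reflexive x≡) (≈-refl ∷ ++⁺ ≋-refl (≈-sym (+-assoc aₖ p c₁) ∷ ≋-refl))))
      (rotated-by ((q + cₘ) ∷ zs) ((a₁ + z′) ∷ as ++ (aₖ + p + c₁) ∷ cs)
        (cong ((a₁ + z′) ∷_) (sym (++-assoc as ((aₖ + p + c₁) ∷ cs) ((q + cₘ) ∷ zs))))
        (trans (⊕-⟪⟫ q (zs ++ (a₁ + z′) ∷ as) (aₖ + p) c₁ cs cₘ)
               (cong ((q + cₘ) ∷_) (++-assoc zs ((a₁ + z′) ∷ as) ((aₖ + p + c₁) ∷ cs)))))
      where
      x≡ : a ⊕ ((p + c₁) ∷ cs ++ (q + cₘ) ∷ zs ++ [ z′ ]) ≡ (a₁ + z′) ∷ as ++ (aₖ + (p + c₁)) ∷ cs ++ (q + cₘ) ∷ zs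
      x≡ = trans (cong (λ t → a ⊕ ((p + c₁) ∷ t)) (sym (++-assoc cs ((q + cₘ) ∷ zs) [ z′ ])))
                 (⊕-⟪⟫ a₁ as aₖ (p + c₁) (cs ++ (q + cₘ) ∷ zs) z′)

  ⊕-insert-last : ∀ a₁ as aₖ c₁ cs cₘ z zs₁ p q →
    Reglued ⟪ a₁ , as , aₖ ⟫ (z ∷ zs₁ ++ p ∷ q ∷ []) ⟪ c₁ , cs , cₘ ⟫
            (⟪ a₁ , as , aₖ ⟫ ⊕ (z ∷ zs₁ ++ (p + c₁) ∷ cs ++ (q + cₘ) ∷ []))
  ⊕-insert-last a₁ as aₖ c₁ cs cₘ z zs₁ p q = ws , ≡⇒≅ (sym a⊕b′≡) , x≅
    where
    a = ⟪ a₁ , as , aₖ ⟫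
    ws = ⟪ a₁ + q , as ++ (aₖ + z) ∷ zs₁ , p ⟫
    a⊕b′≡ : a ⊕ (z ∷ zs₁ ++ p ∷ q ∷ []) ≡ ws
    a⊕b′≡ = begin
      a ⊕ (z ∷ zs₁ ++ p ∷ q ∷ [])                   ≡⟨ cong (λ t → a ⊕ (z ∷ t)) (sym (++-assoc zs₁ [ p ] [ q ])) ⟩
      a ⊕ ⟪ z , zs₁ ++ [ p ] , q ⟫                  ≡⟨ ⊕-⟪⟫ a₁ as aₖ z (zs₁ ++ [ p ]) q ⟩
      (a₁ + q) ∷ as ++ (aₖ + z) ∷ zs₁ ++ [ p ]      ≡⟨ cong ((a₁ + q) ∷_) (sym (++-assoc as ((aₖ + z) ∷ zs₁) [ p ])) ⟩
      ws                                            ∎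
      where open ≡-Reasoning
    x≅ : a ⊕ (z ∷ zs₁ ++ (p + c₁) ∷ cs ++ (q + cₘ) ∷ []) ≅ ws ⊕ ⟪ c₁ , cs , cₘ ⟫
    x≅ = ≋⇒≅ (begin
      a ⊕ (z ∷ zs₁ ++ (p + c₁) ∷ cs ++ [ q + cₘ ])     ≡⟨ cong (λ t → a ⊕ (z ∷ t)) (sym (++-assoc zs₁ ((p + c₁) ∷ cs) [ q + cₘ ])) ⟩
      a ⊕ ⟪ z , zs₁ ++ (p + c₁) ∷ cs , q + cₘ ⟫        ≡⟨ ⊕-⟪⟫ a₁ as aₖ z (zs₁ ++ (p + c₁) ∷ cs) (q + cₘ) ⟩
      (a₁ + (q + cₘ)) ∷ as ++ (aₖ + z) ∷ zs₁ ++ (p + c₁) ∷ cs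
        ≈⟨ ≈-sym (+-assoc a₁ q cₘ) ∷ ≋-reflexive (sym (++-assoc as ((aₖ + z) ∷ zs₁) ((p + c₁) ∷ cs))) ⟩
      (a₁ + q + cₘ) ∷ (as ++ (aₖ + z) ∷ zs₁) ++ (p + c₁) ∷ cs ≡⟨ ⊕-⟪⟫ (a₁ + q) (as ++ (aₖ + z) ∷ zs₁) p c₁ cs cₘ ⟨
      ws ⊕ ⟪ c₁ , cs , cₘ ⟫                            ∎)
      where open SetoidReasoning ≋-setoid

  ⊕-insert-inner : ∀ a₁ as aₖ c₁ cs cₘ z zs₁ p q zs z′ →
    Reglued ⟪ a₁ , as , aₖ ⟫ (z ∷ zs₁ ++ p ∷ q ∷ zs ++ [ z′ ]) ⟪ c₁ , cs , cₘ ⟫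
            (⟪ a₁ , as , aₖ ⟫ ⊕ (z ∷ zs₁ ++ (p + c₁) ∷ cs ++ (q + cₘ) ∷ zs ++ [ z′ ]))
  ⊕-insert-inner a₁ as aₖ c₁ cs cₘ z zs₁ p q zs z′ = ws , ws≅ , x≅
    where
    a = ⟪ a₁ , as , aₖ ⟫
    ms = (a₁ + z′) ∷ as ++ (aₖ + z) ∷ zs₁
    ws = ⟪ q , zs ++ ms , p ⟫
    ws≅ : ws ≅ a ⊕ (z ∷ zs₁ ++ p ∷ q ∷ zs ++ [ z′ ])
    ws≅ = rotated-by (ms ++ [ p ]) (q ∷ zs) (cong (q ∷_) (++-assoc zs ms [ p ])) (begin
      a ⊕ (z ∷ zs₁ ++ p ∷ q ∷ zs ++ [ z′ ])          ≡⟨ cong (λ t → a ⊕ (z ∷ t)) (sym (++-assoc zs₁ (p ∷ q ∷ zs) [ z′ ])) ⟩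
      a ⊕ ⟪ z , zs₁ ++ p ∷ q ∷ zs , z′ ⟫              ≡⟨ ⊕-⟪⟫ a₁ as aₖ z (zs₁ ++ p ∷ q ∷ zs) z′ ⟩
      (a₁ + z′) ∷ as ++ (aₖ + z) ∷ zs₁ ++ p ∷ q ∷ zs  ≡⟨ cong ((a₁ + z′) ∷_) regroup ⟩
      (ms ++ [ p ]) ++ q ∷ zs                         ∎)
      where
      open ≡-Reasoning
      regroup : as ++ (aₖ + z) ∷ zs₁ ++ p ∷ q ∷ zs ≡ ((as ++ (aₖ + z) ∷ zs₁) ++ [ p ]) ++ q ∷ zs
      regroup = ++-solve 5 (λ A K Z P W → A ⊹ K ⊹ Z ⊹ P ⊹ W ⊜ ((A ⊹ K ⊹ Z) ⊹ P) ⊹ W) refl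
                  as [ aₖ + z ] zs₁ [ p ] (q ∷ zs)
    x≅ : a ⊕ (z ∷ zs₁ ++ (p + c₁) ∷ cs ++ (q + cₘ) ∷ zs ++ [ z′ ]) ≅ ws ⊕ ⟪ c₁ , cs , cₘ ⟫
    x≅ = rotated-by ((q + cₘ) ∷ zs) (ms ++ (p + c₁) ∷ cs) (begin
      a ⊕ (z ∷ zs₁ ++ (p + c₁) ∷ cs ++ (q + cₘ) ∷ zs ++ [ z′ ])
        ≡⟨ cong (λ t → a ⊕ (z ∷ t)) regroup₁ ⟩
      a ⊕ ⟪ z , zs₁ ++ (p + c₁) ∷ cs ++ (q + cₘ) ∷ zs , z′ ⟫
        ≡⟨ ⊕-⟪⟫ a₁ as aₖ z (zs₁ ++ (p + c₁) ∷ cs ++ (q + cₘ) ∷ zs) z′ ⟩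
      (a₁ + z′) ∷ as ++ (aₖ + z) ∷ zs₁ ++ (p + c₁) ∷ cs ++ (q + cₘ) ∷ zs
        ≡⟨ cong ((a₁ + z′) ∷_) regroup₂ ⟩
      (ms ++ (p + c₁) ∷ cs) ++ (q + cₘ) ∷ zs          ∎)
      (trans (⊕-⟪⟫ q (zs ++ ms) p c₁ cs cₘ) (cong ((q + cₘ) ∷_) (++-assoc zs ms ((p + c₁) ∷ cs))))
      where
      open ≡-Reasoning
      regroup₁ : zs₁ ++ (p + c₁) ∷ cs ++ (q + cₘ) ∷ zs ++ [ z′ ] ≡ (zs₁ ++ (p + c₁) ∷ cs ++ (q + cₘ) ∷ zs) ++ [ z′ ]
      regroup₁ = ++-solve 6 (λ Z P C Q W E → Z ⊹ P ⊹ C ⊹ Q ⊹ W ⊹ E ⊜ (Z ⊹ P ⊹ C ⊹ Q ⊹ W) ⊹ E) refl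
                   zs₁ [ p + c₁ ] cs [ q + cₘ ] zs [ z′ ]
      regroup₂ : as ++ (aₖ + z) ∷ zs₁ ++ (p + c₁) ∷ cs ++ (q + cₘ) ∷ zs ≡ ((as ++ (aₖ + z) ∷ zs₁) ++ (p + c₁) ∷ cs) ++ (q + cₘ) ∷ zs
      regroup₂ = ++-solve 6 (λ A K Z P C W → A ⊹ K ⊹ Z ⊹ P ⊹ C ⊹ W ⊜ ((A ⊹ K ⊹ Z) ⊹ P ⊹ C) ⊹ W) refl
                   as [ aₖ + z ] zs₁ [ p + c₁ ] cs ((q + cₘ) ∷ zs)

  ⊕-insert-≅ : ∀ a₁ as aₖ c₁ cs cₘ zs₁ p q zs₂ → 2 < length (zs₁ ++ p ∷ q ∷ zs₂) →
    Reglued ⟪ a₁ , as , aₖ ⟫ (zs₁ ++ p ∷ q ∷ zs₂) ⟪ c₁ , cs , cₘ ⟫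
            (⟪ a₁ , as , aₖ ⟫ ⊕ (zs₁ ++ (p + c₁) ∷ cs ++ (q + cₘ) ∷ zs₂))
  ⊕-insert-≅ a₁ as aₖ c₁ cs cₘ [] p q zs₂ 2<n with initLast zs₂ | 2<n
  ... | []        | s<s (s<s ())
  ... | zs ∷ʳ′ z′ | _ = ⊕-insert-first a₁ as aₖ c₁ cs cₘ p q zs z′
  ⊕-insert-≅ a₁ as aₖ c₁ cs cₘ (z ∷ zs₁) p q zs₂ _ with initLast zs₂
  ... | []        = ⊕-insert-last a₁ as aₖ c₁ cs cₘ z zs₁ p q
  ... | zs ∷ʳ′ z′ = ⊕-insert-inner a₁ as aₖ c₁ cs cₘ z zs₁ p q zs z′

  NestedSum : List Carrier → List Carrier → List Carrier → List Carrier → Set _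
  NestedSum a b c x =
    Σ (D (length b)) λ τ₁ → Σ (D (length (a ⊕ (b ^ τ₁)))) λ τ₂ → x ∼ (((a ⊕ (b ^ τ₁)) ^ τ₂) ⊕ c)

  NestedSum-≋ : ∀ a b c {x y} → x ≋ y → NestedSum a b c y → NestedSum a b c x
  NestedSum-≋ _ _ _ x≋y (τ₁ , τ₂ , σ , y≋) = τ₁ , τ₂ , σ , ≋-trans x≋y y≋

  Reglued-reverse : ∀ {a b′ x} c₁ cs cₘ → Reglued a b′ ⟪ cₘ , reverse cs , c₁ ⟫ x → Reglued a b′ ⟪ c₁ , cs , cₘ ⟫ x
  Reglued-reverse c₁ cs cₘ (ws , ws≅ , x≅) = reverse ws , ≅-trans (reverse-≅ ws) ws≅ , ≅-trans x≅ (reverse-⊕-≅ ws c₁ cs cₘ)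

  nestedSum : ∀ a b c {b′ x} → 1 < length a → 1 < length b → 1 < length c →
              b′ ≅ b → Reglued a b′ c x → NestedSum a b c x
  nestedSum a b c 1<a 1<b 1<c b′≅b (ws , ws≅ , x≅) = τ₁ , τ₂ ,
    ≅⇒∼ (≅-trans x≅ (≋⇒≅ (⊕-cong ws≋ ≋-refl)))
        (1<length-⊕ ((a ⊕ (b ^ τ₁)) ^ τ₂) c (1<length-^ (a ⊕ (b ^ τ₁)) τ₂ 1<a⊕b) 1<c)
    where
    τ₁b′ = ≅⇒∼ b′≅b 1<b
    τ₁ = proj₁ τ₁b′
    1<a⊕b = 1<length-⊕ a (b ^ τ₁) 1<a (1<length-^ b τ₁ 1<b)
    τ₂ws = ≅⇒∼ (≅-trans ws≅ (≋⇒≅ (⊕-cong (≋-refl {a}) (proj₂ τ₁b′)))) 1<a⊕b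
    τ₂ = proj₁ τ₂ws
    ws≋ = proj₂ τ₂ws

  ⊕-insert : ∀ a₁ as aₖ b c₁ cs cₘ zs₁ p q zs₂ → 2 < length b → zs₁ ++ p ∷ q ∷ zs₂ ≅ b →
    let a = ⟪ a₁ , as , aₖ ⟫; c = ⟪ c₁ , cs , cₘ ⟫ in
      NestedSum a b c (a ⊕ (zs₁ ++ (p + c₁) ∷ cs ++ (q + cₘ) ∷ zs₂))
    × NestedSum a b c (a ⊕ (zs₁ ++ (p + cₘ) ∷ reverse cs ++ (q + c₁) ∷ zs₂))
  ⊕-insert a₁ as aₖ b c₁ cs cₘ zs₁ p q zs₂ 2<b b′≅b =
    nestedSum a b c 1<a 1<b 1<c b′≅b (⊕-insert-≅ a₁ as aₖ c₁ cs cₘ zs₁ p q zs₂ 2<b′) ,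
    nestedSum a b c 1<a 1<b 1<c b′≅b (Reglued-reverse c₁ cs cₘ (⊕-insert-≅ a₁ as aₖ cₘ (reverse cs) c₁ zs₁ p q zs₂ 2<b′))
    where
    a = ⟪ a₁ , as , aₖ ⟫
    c = ⟪ c₁ , cs , cₘ ⟫
    1<a = 1<length-⟪⟫ a₁ as aₖ
    1<b = <⇒≤ 2<b
    1<c = 1<length-⟪⟫ c₁ cs cₘ
    2<b′ = subst (2 <_) (sym (≅-length b′≅b)) 2<b

  +-comm-pair : ∀ xs u u′ ys v v′ zs → (xs ++ (u + u′) ∷ ys ++ (v + v′) ∷ zs) ≋ (xs ++ (u′ + u) ∷ ys ++ (v′ + v) ∷ zs)
  +-comm-pair xs u u′ ys v v′ zs = ++⁺ (≋-refl {xs}) (+-comm u u′ ∷ ++⁺ (≋-refl {ys}) (+-comm v v′ ∷ ≋-refl))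

  ⊕-comm-∼ : ∀ a₁ as aₖ b₁ bs bₗ → (⟪ a₁ , as , aₖ ⟫ ⊕ ⟪ b₁ , bs , bₗ ⟫) ∼ (⟪ b₁ , bs , bₗ ⟫ ⊕ ⟪ a₁ , as , aₖ ⟫)
  ⊕-comm-∼ a₁ as aₖ b₁ bs bₗ = ≅⇒∼
    (≅-trans (≋⇒≅ (≋-trans (≋-reflexive (⊕-⟪⟫ a₁ as aₖ b₁ bs bₗ)) (+-comm-pair [] a₁ bₗ as aₖ b₁ bs)))
             (rotated-by ((b₁ + aₖ) ∷ bs) ((bₗ + a₁) ∷ as) refl (⊕-⟪⟫ b₁ bs bₗ a₁ as aₖ)))
    (1<length-⊕ ⟪ b₁ , bs , bₗ ⟫ ⟪ a₁ , as , aₖ ⟫ (1<length-⟪⟫ b₁ bs bₗ) (1<length-⟪⟫ a₁ as aₖ))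

  ⟪⟫-rotated : ∀ x xs₁ xs₂ y {xs} → xs ≡ xs₁ ++ xs₂ → xs₂ ++ y ∷ x ∷ xs₁ ≅ ⟪ x , xs , y ⟫
  ⟪⟫-rotated x xs₁ xs₂ y refl =
    rotated-by (x ∷ xs₁) (xs₂ ++ [ y ]) (sym (++-assoc xs₂ [ y ] (x ∷ xs₁))) (cong (x ∷_) (++-assoc xs₁ xs₂ [ y ]))

  ⟪⟫-reflected : ∀ x xs₁ xs₂ y {xs} → xs ≡ xs₁ ++ xs₂ → reverse xs₁ ++ x ∷ y ∷ reverse xs₂ ≅ ⟪ x , xs , y ⟫
  ⟪⟫-reflected x xs₁ xs₂ y xs≡ = ≅-trans (≡⇒≅ (sym (reverse-++-∷-++-∷ xs₂ y [] x xs₁)))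
    (≅-trans (reverse-≅ (xs₂ ++ y ∷ x ∷ xs₁)) (⟪⟫-rotated x xs₁ xs₂ y xs≡))

  -- (b ⊕ c) ^ σ is cut inside the block of b or of c, possibly reflected; the first case yields
  -- the second alternative and conversely.
  ⊕-nested : ∀ a₁ as aₖ b₁ bs bₗ c₁ cs cₘ →
    let a = ⟪ a₁ , as , aₖ ⟫; b = ⟪ b₁ , bs , bₗ ⟫; c = ⟪ c₁ , cs , cₘ ⟫ in
    2 < length b → 2 < length c → (σ : D (length (b ⊕ c))) →
    NestedSum a c b (a ⊕ ((b ⊕ c) ^ σ)) ⊎ NestedSum a b c (a ⊕ ((b ⊕ c) ^ σ))
  ⊕-nested a₁ as aₖ b₁ bs bₗ c₁ cs cₘ 2<b 2<c (s , r) =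
    by-cases s (rotation-cases (b₁ + cₘ) bs (bₗ + c₁) cs (take t y) (drop t y) y≡)
    where
    a = ⟪ a₁ , as , aₖ ⟫
    b = ⟪ b₁ , bs , bₗ ⟫
    c = ⟪ c₁ , cs , cₘ ⟫
    y = b ⊕ c
    t = toℕ r
    y≡ : take t y ++ drop t y ≡ (b₁ + cₘ) ∷ bs ++ (bₗ + c₁) ∷ cs
    y≡ = trans (take++drop≡id t y) (⊕-⟪⟫ b₁ bs bₗ c₁ cs cₘ)
    a⊕ : ∀ {xs ys} → xs ≋ ys → (a ⊕ xs) ≋ (a ⊕ ys)
    a⊕ = ⊕-cong (≋-refl {a})
    by-cases : ∀ s →
      (∃₂ λ bs₁ bs₂ → bs ≡ bs₁ ++ bs₂ × drop t y ++ take t y ≡ bs₂ ++ (bₗ + c₁) ∷ cs ++ (b₁ + cₘ) ∷ bs₁) ⊎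
      (∃₂ λ cs₁ cs₂ → cs ≡ cs₁ ++ cs₂ × drop t y ++ take t y ≡ cs₂ ++ (b₁ + cₘ) ∷ bs ++ (bₗ + c₁) ∷ cs₁) →
      NestedSum a c b (a ⊕ (y ^ (s , r))) ⊎ NestedSum a b c (a ⊕ (y ^ (s , r)))
    by-cases false (inj₁ (bs₁ , bs₂ , bs≡ , e)) = inj₂ (NestedSum-≋ a b c
      (a⊕ (≋-reflexive (trans (^-rotate y r) e)))
      (proj₁ (⊕-insert a₁ as aₖ b c₁ cs cₘ bs₂ bₗ b₁ bs₁ 2<b (⟪⟫-rotated b₁ bs₁ bs₂ bₗ bs≡))))
    by-cases false (inj₂ (cs₁ , cs₂ , cs≡ , e)) = inj₁ (NestedSum-≋ a c b
      (a⊕ (≋-trans (≋-reflexive (trans (^-rotate y r) e)) (+-comm-pair cs₂ b₁ cₘ bs bₗ c₁ cs₁)))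
      (proj₁ (⊕-insert a₁ as aₖ c b₁ bs bₗ cs₂ cₘ c₁ cs₁ 2<c (⟪⟫-rotated c₁ cs₁ cs₂ cₘ cs≡))))
    by-cases true (inj₁ (bs₁ , bs₂ , bs≡ , e)) = inj₂ (NestedSum-≋ a b c
      (a⊕ (≋-reflexive (trans (^-reflect y r) (trans (cong reverse e) (reverse-++-∷-++-∷ bs₂ (bₗ + c₁) cs (b₁ + cₘ) bs₁)))))
      (proj₂ (⊕-insert a₁ as aₖ b c₁ cs cₘ (reverse bs₁) b₁ bₗ (reverse bs₂) 2<b (⟪⟫-reflected b₁ bs₁ bs₂ bₗ bs≡))))
    by-cases true (inj₂ (cs₁ , cs₂ , cs≡ , e)) = inj₁ (NestedSum-≋ a c b
      (a⊕ (≋-trans (≋-reflexive (trans (^-reflect y r) (trans (cong reverse e) (reverse-++-∷-++-∷ cs₂ (b₁ + cₘ) bs (bₗ + c₁) cs₁))))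
                   (+-comm-pair (reverse cs₁) bₗ c₁ (reverse bs) b₁ cₘ (reverse cs₂))))
      (proj₂ (⊕-insert a₁ as aₖ c b₁ bs bₗ (reverse cs₁) c₁ cₘ (reverse cs₂) 2<c (⟪⟫-reflected c₁ cs₁ cs₂ cₘ cs≡))))

module QuiddityCycles {r ℓ} (R : CommutativeRing r ℓ) where
  open CommutativeRing R renaming (refl to ≈-refl; sym to ≈-sym; trans to ≈-trans)
  open Quiddity R
  open Gluing R using (⟪_,_,_⟫; ⊕-⟪⟫)
  open RingProperties ring using (-1*x≈-x; -‿involutive; -‿distribˡ-*; -‿distribʳ-*; +-inverseʳ-unique)
  open NaturalSolver commutativeSemiring using (solve; _:+_; _:*_; _:=_; con)
  open SetoidEquality setoid using ([]; _∷_; ≋-reflexive; ≋-trans; ++⁺)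
  open M2
  open SetoidReasoning setoid

  ≈M-refl : ∀ {M} → M ≈M M
  ≈M-refl = ≈-refl , ≈-refl , ≈-refl , ≈-refl

  ≈M-sym : ∀ {M N} → M ≈M N → N ≈M M
  ≈M-sym {mat _ _ _ _} {mat _ _ _ _} (p , q , r , s) = ≈-sym p , ≈-sym q , ≈-sym r , ≈-sym s

  ≈M-trans : ∀ {M N P} → M ≈M N → N ≈M P → M ≈M P
  ≈M-trans {mat _ _ _ _} {mat _ _ _ _} {mat _ _ _ _} (p , q , r , s) (p′ , q′ , r′ , s′) =
    ≈-trans p p′ , ≈-trans q q′ , ≈-trans r r′ , ≈-trans s s′

  ⊗-cong : ∀ {M M′ N N′} → M ≈M M′ → N ≈M N′ → (M ⊗ N) ≈M (M′ ⊗ N′)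
  ⊗-cong {mat _ _ _ _} {mat _ _ _ _} {mat _ _ _ _} {mat _ _ _ _} (a , b , c , d) (e , f , g , h) =
    +-cong (*-cong a e) (*-cong b g) , +-cong (*-cong a f) (*-cong b h) ,
    +-cong (*-cong c e) (*-cong d g) , +-cong (*-cong c f) (*-cong d h)

  ⊗-assoc : ∀ M N P → ((M ⊗ N) ⊗ P) ≈M (M ⊗ (N ⊗ P))
  ⊗-assoc (mat a b c d) (mat e f g h) (mat i j k l) =
    entry a b e f g h i k , entry a b e f g h j l , entry c d e f g h i k , entry c d e f g h j l
    where
    entry : ∀ a b e f g h i k → (a * e + b * g) * i + (a * f + b * h) * k ≈ a * (e * i + f * k) + b * (g * i + h * k)
    entry = solve 8 (λ a b e f g h i k →
      (a :* e :+ b :* g) :* i :+ (a :* f :+ b :* h) :* k := a :* (e :* i :+ f :* k) :+ b :* (g :* i :+ h :* k)) ≈-refl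

  ⊗-identityˡ : ∀ M → (idM ⊗ M) ≈M M
  ⊗-identityˡ (mat a b c d) = entry a c , entry b d , entry′ a c , entry′ b d
    where
    entry entry′ : ∀ a c → _
    entry  = solve 2 (λ a c → con 1 :* a :+ con 0 :* c := a) ≈-refl
    entry′ = solve 2 (λ a c → con 0 :* a :+ con 1 :* c := c) ≈-refl

  ⊗-identityʳ : ∀ M → (M ⊗ idM) ≈M M
  ⊗-identityʳ (mat a b c d) = entry a b , entry′ a b , entry c d , entry′ c d
    where
    entry entry′ : ∀ a b → _
    entry  = solve 2 (λ a b → a :* con 1 :+ b :* con 0 := a) ≈-refl
    entry′ = solve 2 (λ a b → a :* con 0 :+ b :* con 1 := b) ≈-refl

  prodη-cong : ∀ {xs ys} → xs ≋ ys → prodη xs ≈M prodη ys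
  prodη-cong []           = ≈M-refl
  prodη-cong (x≈y ∷ xs≋) = ⊗-cong (x≈y , ≈-refl , ≈-refl , ≈-refl) (prodη-cong xs≋)

  prodη-∷ʳ : ∀ xs y → prodη (xs ++ [ y ]) ≈M (prodη xs ⊗ η y)
  prodη-∷ʳ []       y = ≈M-trans (⊗-identityʳ (η y)) (≈M-sym (⊗-identityˡ (η y)))
  prodη-∷ʳ (x ∷ xs) y = ≈M-trans (⊗-cong (≈M-refl {η x}) (prodη-∷ʳ xs y)) (≈M-sym (⊗-assoc (η x) (prodη xs) (η y)))

  signVal² : ∀ μ → signVal μ * signVal μ ≈ 1#
  signVal² Sign.+ = *-identityˡ 1#
  signVal² Sign.- = ≈-trans (-1*x≈-x (- 1#)) (-‿involutive 1#)

  η-sandwich-entries : ∀ μ x y p q r s → (η x ⊗ (mat p q r s ⊗ η y)) ≈M scal μ idM →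
                       - p ≈ μ × p * y + q ≈ 0# × x * μ + r ≈ 0#
  η-sandwich-entries μ x y p q r s (_ , e12 , e21 , e22) = -p≈μ , py+q≈0 , xμ+r≈0
    where
    first-row : ∀ u v → 1# * u + 0# * v ≈ u
    first-row = solve 2 (λ u v → con 1 :* u :+ con 0 :* v := u) ≈-refl
    times-1 : ∀ u w → u * - 1# + w * 0# ≈ - u
    times-1 u w = begin
      u * - 1# + w * 0#   ≈⟨ +-cong (-‿distribʳ-* u 1#) (≈-sym (zeroʳ w)) ⟨
      - (u * 1#) + 0#     ≈⟨ +-identityʳ _ ⟩
      - (u * 1#)          ≈⟨ -‿cong (*-identityʳ u) ⟩
      - u                 ∎
    -p≈μ : - p ≈ μ
    -p≈μ = begin
      - p                                                   ≈⟨ times-1 p q ⟨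
      p * - 1# + q * 0#                                     ≈⟨ first-row _ _ ⟨
      1# * (p * - 1# + q * 0#) + 0# * (r * - 1# + s * 0#)  ≈⟨ e22 ⟩
      μ * 1#                                                ≈⟨ *-identityʳ μ ⟩
      μ                                                     ∎
    py+q≈0 : p * y + q ≈ 0#
    py+q≈0 = begin
      p * y + q                                             ≈⟨ +-congˡ (*-identityʳ q) ⟨
      p * y + q * 1#                                        ≈⟨ first-row _ _ ⟨
      1# * (p * y + q * 1#) + 0# * (r * y + s * 1#)        ≈⟨ e21 ⟩
      μ * 0#                                                ≈⟨ zeroʳ μ ⟩
      0#                                                    ∎
    -1*[r*-1+s*0]≈r : - 1# * (r * - 1# + s * 0#) ≈ r
    -1*[r*-1+s*0]≈r = ≈-trans (-1*x≈-x _) (≈-trans (-‿cong (times-1 r s)) (-‿involutive r))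
    xμ+r≈0 : x * μ + r ≈ 0#
    xμ+r≈0 = begin
      x * μ + r                                             ≈⟨ +-cong (*-congˡ (≈-trans (times-1 p q) -p≈μ)) -1*[r*-1+s*0]≈r ⟨
      x * (p * - 1# + q * 0#) + - 1# * (r * - 1# + s * 0#) ≈⟨ e12 ⟩
      μ * 0#                                                ≈⟨ zeroʳ μ ⟩
      0#                                                    ∎

  η-sandwich-ends : ∀ μ x y P → μ * μ ≈ 1# → (η x ⊗ (P ⊗ η y)) ≈M scal μ idM →
                    y ≈ μ * m12 P × x ≈ μ * (- m21 P)
  η-sandwich-ends μ x y (mat p q r s) μ²≈1 sandwich with η-sandwich-entries μ x y p q r s sandwich
  ... | -p≈μ , py+q≈0 , xμ+r≈0 = y≈μq , x≈-μr
    where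
    μ[μz]≈z : ∀ z → μ * (μ * z) ≈ z
    μ[μz]≈z z = ≈-trans (≈-sym (*-assoc μ μ z)) (≈-trans (*-congʳ μ²≈1) (*-identityˡ z))
    y≈μq : y ≈ μ * q
    y≈μq = begin
      y              ≈⟨ μ[μz]≈z y ⟨
      μ * (μ * y)    ≈⟨ *-congˡ (*-congʳ -p≈μ) ⟨
      μ * (- p * y)  ≈⟨ *-congˡ (-‿distribˡ-* p y) ⟨
      μ * - (p * y)  ≈⟨ *-congˡ (+-inverseʳ-unique (p * y) q py+q≈0) ⟨
      μ * q          ∎
    x≈-μr : x ≈ μ * (- r)
    x≈-μr = begin
      x               ≈⟨ μ[μz]≈z x ⟨
      μ * (μ * x)     ≈⟨ *-congˡ (*-comm x μ) ⟨
      μ * (x * μ)     ≈⟨ *-congˡ (-‿involutive (x * μ)) ⟨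
      μ * - - (x * μ) ≈⟨ *-congˡ (-‿cong (+-inverseʳ-unique (x * μ) r xμ+r≈0)) ⟨
      μ * (- r)       ∎

  quiddity-ends : ∀ μ x xs y → IsQuiddityCycle μ ⟪ x , xs , y ⟫ →
                  y ≈ signVal μ * m12 (prodη xs) × x ≈ signVal μ * (- m21 (prodη xs))
  quiddity-ends μ x xs y cycle = η-sandwich-ends (signVal μ) x y (prodη xs) (signVal² μ)
    (≈M-trans (⊗-cong (≈M-refl {η x}) (≈M-sym (prodη-∷ʳ xs y))) cycle)

  ≋-++-prefix : ∀ {ws xs ys zs} → length ws ≡ length xs → (ws ++ ys) ≋ (xs ++ zs) → ws ≋ xs
  ≋-++-prefix {[]}    {[]}    _  _            = []
  ≋-++-prefix {_ ∷ _} {_ ∷ _} eq (w≈x ∷ rest) = w≈x ∷ ≋-++-prefix (suc-injective eq) rest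

  ⊕-cancel : ∀ μ a₁ as aₖ b₁ bs bₗ → IsQuiddityCycle μ ⟪ a₁ , as , aₖ ⟫ → IsQuiddityCycle μ ⟪ b₁ , bs , bₗ ⟫ →
    length ⟪ a₁ , as , aₖ ⟫ ≡ length ⟪ b₁ , bs , bₗ ⟫ →
    (⟪ a₁ , as , aₖ ⟫ ⊕ ⟪ b₁ , bs , bₗ ⟫) ≋ (⟪ b₁ , bs , bₗ ⟫ ⊕ ⟪ a₁ , as , aₖ ⟫) → ⟪ a₁ , as , aₖ ⟫ ≋ ⟪ b₁ , bs , bₗ ⟫
  ⊕-cancel μ a₁ as aₖ b₁ bs bₗ a-cycle b-cycle |a|≡|b| a⊕b≋b⊕a = a₁≈b₁ ∷ ++⁺ as≋bs (aₖ≈bₗ ∷ [])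
    where
    |as|≡|bs| : length as ≡ length bs
    |as|≡|bs| = +-cancelʳ-≡ 1 (length as) (length bs)
      (trans (sym (length-++ as)) (trans (suc-injective |a|≡|b|) (length-++ bs)))
    as≋bs : as ≋ bs
    as≋bs = ≋-++-prefix |as|≡|bs| (tail (≋-trans (≋-reflexive (sym (⊕-⟪⟫ a₁ as aₖ b₁ bs bₗ)))
                                      (≋-trans a⊕b≋b⊕a (≋-reflexive (⊕-⟪⟫ b₁ bs bₗ a₁ as aₖ)))))
    a-ends = quiddity-ends μ a₁ as aₖ a-cycle
    b-ends = quiddity-ends μ b₁ bs bₗ b-cycle
    same-interior = prodη-cong as≋bs
    aₖ≈bₗ : aₖ ≈ bₗ
    aₖ≈bₗ = ≈-trans (proj₁ a-ends) (≈-trans (*-congˡ (proj₁ (proj₂ same-interior))) (≈-sym (proj₁ b-ends)))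
    a₁≈b₁ : a₁ ≈ b₁
    a₁≈b₁ = ≈-trans (proj₂ a-ends)
      (≈-trans (*-congˡ (-‿cong (proj₁ (proj₂ (proj₂ same-interior))))) (≈-sym (proj₂ b-ends)))

theorem2p3 : ∀ {c ℓ r} (A : CommutativeRing c ℓ) →
    let open CommutativeRing A using (Carrier) in
    let open Quiddity A in
    (R : Carrier → Set r) (λ₁ λ₂ λ₃ : Sign) (a b c : List Carrier) →
    All R a → All R b → All R c →
    2 < length a → 2 < length b → 2 < length c →
    IsQuiddityCycle λ₁ a → IsQuiddityCycle λ₂ b → IsQuiddityCycle λ₃ c →
    ((a ⊕ b) ∼ (b ⊕ a))
    × Σ (D (length b)) (λ τ → Σ (D (length ((b ^ τ) ⊕ c))) λ σ →
        ((a ⊕ b) ⊕ c) ≋ (a ⊕ (((b ^ τ) ⊕ c) ^ σ)))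
    × ((σ : D (length (b ⊕ c))) →
        Σ (D (length c)) (λ τ₁ → Σ (D (length (a ⊕ (c ^ τ₁)))) λ τ₂ →
          (a ⊕ ((b ⊕ c) ^ σ)) ∼ (((a ⊕ (c ^ τ₁)) ^ τ₂) ⊕ b))
        ⊎ Σ (D (length b)) (λ τ₁ → Σ (D (length (a ⊕ (b ^ τ₁)))) λ τ₂ →
          (a ⊕ ((b ⊕ c) ^ σ)) ∼ (((a ⊕ (b ^ τ₁)) ^ τ₂) ⊕ c)))
    × (length a ≡ length b → λ₁ ≡ λ₂ → (a ⊕ b) ≋ (b ⊕ a) → a ≋ b)
theorem2p3 A _ λ₁ _ _ a b c _ _ _ 2<a 2<b 2<c a-cycle b-cycle _
  with Gluing.framed A a (<⇒≤ 2<a) | Gluing.framed A b (<⇒≤ 2<b) | Gluing.framed A c (<⇒≤ 2<c)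
... | a₁ , as , aₖ , refl | b₁ , bs , bₗ , refl | c₁ , cs , cₘ , refl =
    ⊕-comm-∼ a₁ as aₖ b₁ bs bₗ ,
    ⊕-assoc-∼ a₁ as aₖ b₁ bs bₗ c₁ cs cₘ 2<b ,
    ⊕-nested a₁ as aₖ b₁ bs bₗ c₁ cs cₘ 2<b 2<c ,
    λ { |a|≡|b| refl → ⊕-cancel λ₁ a₁ as aₖ b₁ bs bₗ a-cycle b-cycle |a|≡|b| }
  where
  open Gluing A
  open QuiddityCycles A
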